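{- Let $n \in \mathbb N$ and $w = \langle n\rangle$. Then: (i) $w1 \in \mathcal L$ if and only if $n$ is odd, and in that case $w1 = \langle (3n+1)/2\rangle = \langle T(n)\rangle$; (ii) $w0 \in \mathcal L$ if and only if $n$ is even, if and only if $w2 \in \mathcal L$; and in that case $w0 = \langle 3n/2\rangle$ and $w2 = \langle (3n+2)/2\rangle$.
   Context: $\mathbb N=\{0,1,2,\dots\}$. Every $n \in \mathbb N$ has a unique expression $n = \frac12\sum_{i=0}^k a_i (3/2)^i$ with digits $a_i \in \{0,1,2\}$ and $a_k \neq 0$ if $n \ge 1$; its representation in rational base $3/2$ is the word $\langle n\rangle = a_k\cdots a_0 \in \{0,1,2\}^*$, with $\langle 0\rangle$ the empty word, and any word $0w$ is identified with $w$. $\mathcal L = \{\langle n\rangle : n \in \mathbb N\}$ is the language of admissible words. $T:\mathbb N\to\mathbb N$ is the Collatz function: $T(n)=n/2$ for $n$ even, $T(n)=(3n+1)/2$ for $n$ odd. $wa$ denotes the word $w$ followed by the digit $a$. -}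

module Defs where

open import Data.Nat as ℕ using (ℕ; zero; suc)
open import Data.Nat.Divisibility using (_∣_)
open import Data.Nat.DivMod using (_/_; _%_)
open import Data.Fin using (Fin; toℕ) renaming (zero to fzero)
open import Data.Unit using (⊤)
import Data.Fin
open import Data.List using (List; []; _∷_; reverse; _∷ʳ_)
open import Data.Integer using (+_)
open import Data.Rational using (ℚ; 0ℚ; 1ℚ; _+_; _*_; ½)
import Data.Rational as Q
open import Data.Product using (Σ; ∃; _×_)
open import Relation.Binary.PropositionalEquality using (_≡_; _≢_)
open import Relation.Nullary using (¬_)

Digit : Set
Digit = Fin 3

d0 d1 d2 : Digit
d0 = fzero
d1 = Data.Fin.suc fzero
d2 = Data.Fin.suc (Data.Fin.suc fzero)

-- A word a_k ⋯ a_0, stored most significant digit first (as written),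
-- so the word  w a  (w followed by digit a) is  w ∷ʳ a.
Word : Set
Word = List Digit

ℕ→ℚ : ℕ → ℚ
ℕ→ℚ n = (+ n) Q./ 1

threeHalves : ℚ
threeHalves = (+ 3) Q./ 2

pow : ℚ → ℕ → ℚ
pow q zero    = 1ℚ
pow q (suc i) = q * pow q i

-- Σ_{j} a_{i+j} (3/2)^{i+j} over a list of digits given least significant first
-- (the j-th entry of the list is the digit a_{i+j})
digitSum : ℕ → List Digit → ℚ
digitSum i []       = 0ℚ
digitSum i (a ∷ ds) = ℕ→ℚ (toℕ a) * pow threeHalves i + digitSum (suc i) ds

val : Word → ℚ
val w = ½ * digitSum 0 (reverse w)

NoLeadingZero : Word → Set
NoLeadingZero []      = ⊤
NoLeadingZero (a ∷ _) = toℕ a ≢ 0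

strip : Word → Word
strip []      = []
strip (fzero ∷ w) = strip w
strip (a ∷ w) = a ∷ w

-- "w is the representation ⟨n⟩ of n in base 3/2": w has no leading zero and
-- its value is n.  (By the uniqueness fact in the context, for each n there is
-- exactly one such w; we use this relation in place of the function ⟨_⟩.)
IsRep : ℕ → Word → Set
IsRep n w = NoLeadingZero w × val w ≡ ℕ→ℚ n

RepUpToZeros : ℕ → Word → Set
RepUpToZeros n w = IsRep n (strip w)

InL : Word → Set
InL w = ∃ λ n → RepUpToZeros n w

Even : ℕ → Set
Even n = 2 ∣ n

Odd : ℕ → Set
Odd n = ¬ (2 ∣ n)

T : ℕ → ℕ
T n with n ℕ.% 2
... | zero  = n / 2
... | suc _ = (3 ℕ.* n ℕ.+ 1) / 2

{-# OPTIONS --safe #-}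
module Submission where

-- Appending a digit a to a word of value v gives the value (a + 3v)/2, since every
-- existing digit moves one place up and so gains a factor 3/2.  Hence, for w = ⟨n⟩,
-- the word w a is admissible exactly when 2 divides a + 3n, i.e. a + n; it then
-- represents (a + 3n)/2.  So the digit 1 needs n odd, and the digits 0 and 2 need n even.

open import Defs
open import Data.Fin using (toℕ) renaming (zero to fzero; suc to fsuc)
open import Data.Integer as ℤ using (+_)
import Data.Integer.Properties as ℤ
open import Data.List using ([]; _∷_; _∷ʳ_; reverse)
open import Data.List.Properties using (reverse-++; unfold-reverse)
open import Data.Nat using (ℕ; zero; suc; _+_; _*_)
import Data.Nat.Properties as ℕ
open import Data.Nat.Divisibility
  using (_∣_; divides; ∣-refl; _∣0; ∣m∣n⇒∣m+n; ∣m+n∣m⇒∣n; >⇒∤; m%n≡0⇒n∣m; m∣m*n)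
open import Data.Nat.DivMod using (_/_; _%_; m*[n/m]≡n)
open import Data.Product using (_×_; _,_)
open import Data.Rational as ℚ using (½; toℚᵘ)
import Data.Rational.Properties as ℚ
open import Data.Rational.Solver using (module +-*-Solver)
open import Data.Rational.Unnormalised as ℚᵘ using (ℚᵘ; mkℚᵘ; *≡*)
import Data.Rational.Unnormalised.Properties as ℚᵘ
open import Data.Unit using (tt)
open import Function.Bundles using (_⇔_; mk⇔; Equivalence)
open import Function.Construct.Composition using (_⇔-∘_)
open import Function.Construct.Symmetry using (⇔-sym)
open import Function.Definitions using (Injective)
open import Relation.Binary.PropositionalEquality
open import Relation.Nullary using (contradiction)

open Equivalence

ℕ→ℚᵘ : ℕ → ℚᵘ
ℕ→ℚᵘ k = mkℚᵘ (+ k) 0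

ℕ→ℚᵘ-injective : ∀ {a b} → ℕ→ℚᵘ a ℚᵘ.≃ ℕ→ℚᵘ b → a ≡ b
ℕ→ℚᵘ-injective {a} {b} (*≡* eq) = ℤ.+-injective (begin
  + a          ≡⟨ ℤ.*-identityʳ (+ a) ⟨
  + a ℤ.* + 1  ≡⟨ eq ⟩
  + b ℤ.* + 1  ≡⟨ ℤ.*-identityʳ (+ b) ⟩
  + b          ∎)
  where open ≡-Reasoning

-- ℕ→ℚ k is definitionally fromℚᵘ (ℕ→ℚᵘ k); identities are checked in ℚᵘ, where
-- nothing has to be normalised.
toℚᵘ-ℕ→ℚ : ∀ k → toℚᵘ (ℕ→ℚ k) ℚᵘ.≃ ℕ→ℚᵘ k
toℚᵘ-ℕ→ℚ k = ℚ.toℚᵘ-fromℚᵘ (ℕ→ℚᵘ k)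

ℕ→ℚ-injective : Injective _≡_ _≡_ ℕ→ℚ
ℕ→ℚ-injective {a} {b} eq = ℕ→ℚᵘ-injective (begin
  ℕ→ℚᵘ a          ≈⟨ toℚᵘ-ℕ→ℚ a ⟨
  toℚᵘ (ℕ→ℚ a)   ≡⟨ cong toℚᵘ eq ⟩
  toℚᵘ (ℕ→ℚ b)   ≈⟨ toℚᵘ-ℕ→ℚ b ⟩
  ℕ→ℚᵘ b          ∎)
  where open ℚᵘ.≃-Reasoning

ℕ→ℚ-homo-+ : ∀ a b → ℕ→ℚ (a + b) ≡ ℕ→ℚ a ℚ.+ ℕ→ℚ b
ℕ→ℚ-homo-+ a b = ℚ.toℚᵘ-injective (begin
  toℚᵘ (ℕ→ℚ (a + b))                    ≈⟨ toℚᵘ-ℕ→ℚ (a + b) ⟩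
  ℕ→ℚᵘ (a + b)                          ≈⟨ *≡* (cong (ℤ._* + 1) pos-+) ⟩
  ℕ→ℚᵘ a ℚᵘ.+ ℕ→ℚᵘ b                    ≈⟨ ℚᵘ.+-cong (toℚᵘ-ℕ→ℚ a) (toℚᵘ-ℕ→ℚ b) ⟨
  toℚᵘ (ℕ→ℚ a) ℚᵘ.+ toℚᵘ (ℕ→ℚ b)        ≈⟨ ℚ.toℚᵘ-homo-+ (ℕ→ℚ a) (ℕ→ℚ b) ⟨
  toℚᵘ (ℕ→ℚ a ℚ.+ ℕ→ℚ b)                ∎)
  where
  open ℚᵘ.≃-Reasoning
  pos-+ : + (a + b) ≡ + a ℤ.* + 1 ℤ.+ + b ℤ.* + 1
  pos-+ = trans (ℤ.pos-+ a b) (sym (cong₂ ℤ._+_ (ℤ.*-identityʳ (+ a)) (ℤ.*-identityʳ (+ b))))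

ℕ→ℚ-homo-* : ∀ a b → ℕ→ℚ (a * b) ≡ ℕ→ℚ a ℚ.* ℕ→ℚ b
ℕ→ℚ-homo-* a b = ℚ.toℚᵘ-injective (begin
  toℚᵘ (ℕ→ℚ (a * b))                    ≈⟨ toℚᵘ-ℕ→ℚ (a * b) ⟩
  ℕ→ℚᵘ (a * b)                          ≈⟨ *≡* (cong (ℤ._* + 1) (ℤ.pos-* a b)) ⟩
  ℕ→ℚᵘ a ℚᵘ.* ℕ→ℚᵘ b                    ≈⟨ ℚᵘ.*-cong (toℚᵘ-ℕ→ℚ a) (toℚᵘ-ℕ→ℚ b) ⟨
  toℚᵘ (ℕ→ℚ a) ℚᵘ.* toℚᵘ (ℕ→ℚ b)        ≈⟨ ℚ.toℚᵘ-homo-* (ℕ→ℚ a) (ℕ→ℚ b) ⟨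
  toℚᵘ (ℕ→ℚ a ℚ.* ℕ→ℚ b)                ∎)
  where open ℚᵘ.≃-Reasoning

double-injective : ∀ {p q} → ℕ→ℚ 2 ℚ.* p ≡ ℕ→ℚ 2 ℚ.* q → p ≡ q
double-injective {p} {q} eq = begin
  p                        ≡⟨ half-double p ⟨
  ½ ℚ.* (ℕ→ℚ 2 ℚ.* p)      ≡⟨ cong (½ ℚ.*_) eq ⟩
  ½ ℚ.* (ℕ→ℚ 2 ℚ.* q)      ≡⟨ half-double q ⟩
  q                        ∎
  where
  open ≡-Reasoning
  half-double : ∀ r → ½ ℚ.* (ℕ→ℚ 2 ℚ.* r) ≡ r
  half-double r = trans (sym (ℚ.*-assoc ½ (ℕ→ℚ 2) r)) (ℚ.*-identityˡ r)

digitSum-suc : ∀ i ds → digitSum (suc i) ds ≡ threeHalves ℚ.* digitSum i ds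
digitSum-suc i []       = refl
digitSum-suc i (a ∷ ds) = begin
  ℕ→ℚ (toℕ a) ℚ.* (threeHalves ℚ.* pow threeHalves i) ℚ.+ digitSum (suc (suc i)) ds
    ≡⟨ cong (ℕ→ℚ (toℕ a) ℚ.* (threeHalves ℚ.* pow threeHalves i) ℚ.+_) (digitSum-suc (suc i) ds) ⟩
  ℕ→ℚ (toℕ a) ℚ.* (threeHalves ℚ.* pow threeHalves i) ℚ.+ threeHalves ℚ.* digitSum (suc i) ds
    ≡⟨ solve 3 (λ x p s → x :* (con threeHalves :* p) :+ con threeHalves :* s
                        := con threeHalves :* (x :* p :+ s)) refl
             (ℕ→ℚ (toℕ a)) (pow threeHalves i) (digitSum (suc i) ds) ⟩
  threeHalves ℚ.* (ℕ→ℚ (toℕ a) ℚ.* pow threeHalves i ℚ.+ digitSum (suc i) ds) ∎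
  where open +-*-Solver; open ≡-Reasoning

double-val-∷ʳ : ∀ w a → ℕ→ℚ 2 ℚ.* val (w ∷ʳ a) ≡ ℕ→ℚ (toℕ a) ℚ.+ ℕ→ℚ 3 ℚ.* val w
double-val-∷ʳ w a = begin
  ℕ→ℚ 2 ℚ.* (½ ℚ.* digitSum 0 (reverse (w ∷ʳ a)))
    ≡⟨ cong (λ ds → ℕ→ℚ 2 ℚ.* (½ ℚ.* digitSum 0 ds)) (reverse-++ w (a ∷ [])) ⟩
  ℕ→ℚ 2 ℚ.* (½ ℚ.* (ℕ→ℚ (toℕ a) ℚ.* ℚ.1ℚ ℚ.+ digitSum 1 (reverse w)))
    ≡⟨ cong (λ s → ℕ→ℚ 2 ℚ.* (½ ℚ.* (ℕ→ℚ (toℕ a) ℚ.* ℚ.1ℚ ℚ.+ s))) (digitSum-suc 0 (reverse w)) ⟩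
  ℕ→ℚ 2 ℚ.* (½ ℚ.* (ℕ→ℚ (toℕ a) ℚ.* ℚ.1ℚ ℚ.+ threeHalves ℚ.* digitSum 0 (reverse w)))
    ≡⟨ solve 2 (λ x s → con (ℕ→ℚ 2) :* (con ½ :* (x :* con ℚ.1ℚ :+ con threeHalves :* s))
                      := x :+ con (ℕ→ℚ 3) :* (con ½ :* s)) refl
             (ℕ→ℚ (toℕ a)) (digitSum 0 (reverse w)) ⟩
  ℕ→ℚ (toℕ a) ℚ.+ ℕ→ℚ 3 ℚ.* val w ∎
  where open +-*-Solver; open ≡-Reasoning

digitSum-∷ʳ-0 : ∀ i ds → digitSum i (ds ∷ʳ d0) ≡ digitSum i ds
digitSum-∷ʳ-0 i []       = trans (ℚ.+-identityʳ _) (ℚ.*-zeroˡ (pow threeHalves i))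
digitSum-∷ʳ-0 i (a ∷ ds) = cong (ℕ→ℚ (toℕ a) ℚ.* pow threeHalves i ℚ.+_) (digitSum-∷ʳ-0 (suc i) ds)

val-strip : ∀ w → val (strip w) ≡ val w
val-strip []           = refl
val-strip (fzero ∷ w)  = begin
  val (strip w)                      ≡⟨ val-strip w ⟩
  ½ ℚ.* digitSum 0 (reverse w)       ≡⟨ cong (½ ℚ.*_) (digitSum-∷ʳ-0 0 (reverse w)) ⟨
  ½ ℚ.* digitSum 0 (reverse w ∷ʳ d0) ≡⟨ cong (λ ds → ½ ℚ.* digitSum 0 ds) (unfold-reverse d0 w) ⟨
  val (d0 ∷ w)                       ∎
  where open ≡-Reasoning
val-strip (fsuc a ∷ w) = refl

noLeadingZero-strip : ∀ w → NoLeadingZero (strip w)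
noLeadingZero-strip []           = tt
noLeadingZero-strip (fzero ∷ w)  = noLeadingZero-strip w
noLeadingZero-strip (fsuc a ∷ w) = λ ()

repUpToZeros⇔val≡ : ∀ m w → RepUpToZeros m w ⇔ val w ≡ ℕ→ℚ m
repUpToZeros⇔val≡ m w = mk⇔
  (λ (_ , val≡) → trans (sym (val-strip w)) val≡)
  (λ val≡ → noLeadingZero-strip w , trans (val-strip w) val≡)

∣m+n⇔∣m : ∀ {d m n} → d ∣ n → (d ∣ m + n ⇔ d ∣ m)
∣m+n⇔∣m {d} {m} {n} d∣n = mk⇔
  (λ d∣m+n → ∣m+n∣m⇒∣n (subst (d ∣_) (ℕ.+-comm m n) d∣m+n) d∣n)
  (λ d∣m → ∣m∣n⇒∣m+n d∣m d∣n)

∣m+n⇔∣n : ∀ {d m n} → d ∣ m → (d ∣ m + n ⇔ d ∣ n)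
∣m+n⇔∣n d∣m = mk⇔ (λ d∣m+n → ∣m+n∣m⇒∣n d∣m+n d∣m) (∣m∣n⇒∣m+n d∣m)

2∣m+3n⇔2∣m+n : ∀ m n → 2 ∣ m + 3 * n ⇔ 2 ∣ m + n
2∣m+3n⇔2∣m+n m n =
  subst (λ k → 2 ∣ k ⇔ 2 ∣ m + n) (ℕ.+-assoc m n (2 * n)) (∣m+n⇔∣m (m∣m*n n))

odd⇒even-suc : ∀ {n} → Odd n → Even (suc n)
odd⇒even-suc {zero}        odd = contradiction (2 ∣0) odd
odd⇒even-suc {suc zero}    _   = ∣-refl
odd⇒even-suc {suc (suc n)} odd =
  ∣m∣n⇒∣m+n ∣-refl (odd⇒even-suc (λ 2∣n → odd (∣m∣n⇒∣m+n ∣-refl 2∣n)))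

even-suc⇔odd : ∀ n → Even (suc n) ⇔ Odd n
even-suc⇔odd n = mk⇔
  (λ 2∣1+n 2∣n → >⇒∤ ℕ.≤-refl (to (∣m+n⇔∣m 2∣n) 2∣1+n))
  odd⇒even-suc

T-odd : ∀ {n} → Odd n → T n ≡ (3 * n + 1) / 2
T-odd {n} odd with n % 2 in eq
... | zero  = contradiction (m%n≡0⇒n∣m n 2 eq) odd
... | suc _ = refl

module AppendDigit (n : ℕ) (w : Word) (val-w : val w ≡ ℕ→ℚ n) (a : Digit) where

  repUpToZeros-∷ʳ⇔ : ∀ m → RepUpToZeros m (w ∷ʳ a) ⇔ 2 * m ≡ toℕ a + 3 * n
  repUpToZeros-∷ʳ⇔ m = mk⇔ to′ from′ ⇔-∘ repUpToZeros⇔val≡ m (w ∷ʳ a)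
    where
    open ≡-Reasoning
    double-val : ℕ→ℚ 2 ℚ.* val (w ∷ʳ a) ≡ ℕ→ℚ (toℕ a + 3 * n)
    double-val = begin
      ℕ→ℚ 2 ℚ.* val (w ∷ʳ a)               ≡⟨ double-val-∷ʳ w a ⟩
      ℕ→ℚ (toℕ a) ℚ.+ ℕ→ℚ 3 ℚ.* val w      ≡⟨ cong (λ v → ℕ→ℚ (toℕ a) ℚ.+ ℕ→ℚ 3 ℚ.* v) val-w ⟩
      ℕ→ℚ (toℕ a) ℚ.+ ℕ→ℚ 3 ℚ.* ℕ→ℚ n      ≡⟨ cong (ℕ→ℚ (toℕ a) ℚ.+_) (ℕ→ℚ-homo-* 3 n) ⟨
      ℕ→ℚ (toℕ a) ℚ.+ ℕ→ℚ (3 * n)          ≡⟨ ℕ→ℚ-homo-+ (toℕ a) (3 * n) ⟨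
      ℕ→ℚ (toℕ a + 3 * n)                  ∎
    to′ : val (w ∷ʳ a) ≡ ℕ→ℚ m → 2 * m ≡ toℕ a + 3 * n
    to′ val≡ = ℕ→ℚ-injective (begin
      ℕ→ℚ (2 * m)               ≡⟨ ℕ→ℚ-homo-* 2 m ⟩
      ℕ→ℚ 2 ℚ.* ℕ→ℚ m           ≡⟨ cong (ℕ→ℚ 2 ℚ.*_) val≡ ⟨
      ℕ→ℚ 2 ℚ.* val (w ∷ʳ a)    ≡⟨ double-val ⟩
      ℕ→ℚ (toℕ a + 3 * n)       ∎)
    from′ : 2 * m ≡ toℕ a + 3 * n → val (w ∷ʳ a) ≡ ℕ→ℚ m
    from′ eq = double-injective (begin
      ℕ→ℚ 2 ℚ.* val (w ∷ʳ a)    ≡⟨ double-val ⟩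
      ℕ→ℚ (toℕ a + 3 * n)       ≡⟨ cong ℕ→ℚ eq ⟨
      ℕ→ℚ (2 * m)               ≡⟨ ℕ→ℚ-homo-* 2 m ⟩
      ℕ→ℚ 2 ℚ.* ℕ→ℚ m           ∎)

  rep-∷ʳ : 2 ∣ toℕ a + n → RepUpToZeros ((toℕ a + 3 * n) / 2) (w ∷ʳ a)
  rep-∷ʳ 2∣a+n = from (repUpToZeros-∷ʳ⇔ ((toℕ a + 3 * n) / 2))
                       (m*[n/m]≡n (from (2∣m+3n⇔2∣m+n (toℕ a) n) 2∣a+n))

  inL-∷ʳ⇔ : InL (w ∷ʳ a) ⇔ 2 ∣ toℕ a + n
  inL-∷ʳ⇔ = mk⇔
    (λ (m , rep) → to (2∣m+3n⇔2∣m+n (toℕ a) n)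
                      (divides m (trans (sym (to (repUpToZeros-∷ʳ⇔ m) rep)) (ℕ.*-comm 2 m))))
    (λ 2∣a+n → (toℕ a + 3 * n) / 2 , rep-∷ʳ 2∣a+n)

proposition7 : (n : ℕ) (w : Word) → IsRep n w →
    ((InL (w ∷ʳ d1) ⇔ Odd n)
      × (Odd n → RepUpToZeros ((3 * n + 1) / 2) (w ∷ʳ d1)
                 × RepUpToZeros (T n) (w ∷ʳ d1)))
    × ((InL (w ∷ʳ d0) ⇔ Even n)
      × (Even n ⇔ InL (w ∷ʳ d2))
      × (Even n → RepUpToZeros ((3 * n) / 2) (w ∷ʳ d0)
                  × RepUpToZeros ((3 * n + 2) / 2) (w ∷ʳ d2)))
proposition7 n w (_ , val-w) =
  ( inL₁ , λ odd → rep₁ odd , subst (λ k → RepUpToZeros k (w ∷ʳ d1)) (sym (T-odd odd)) (rep₁ odd) )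
  , ( inL-∷ʳ⇔ d0 , ⇔-sym inL₂ , λ even → rep-∷ʳ d0 even , rep₂ even )
  where
  open AppendDigit n w val-w
  inL₁ : InL (w ∷ʳ d1) ⇔ Odd n
  inL₁ = even-suc⇔odd n ⇔-∘ inL-∷ʳ⇔ d1
  inL₂ : InL (w ∷ʳ d2) ⇔ Even n
  inL₂ = ∣m+n⇔∣n ∣-refl ⇔-∘ inL-∷ʳ⇔ d2
  rep₁ : Odd n → RepUpToZeros ((3 * n + 1) / 2) (w ∷ʳ d1)
  rep₁ odd = subst (λ k → RepUpToZeros (k / 2) (w ∷ʳ d1)) (ℕ.+-comm 1 (3 * n))
                   (rep-∷ʳ d1 (from (even-suc⇔odd n) odd))
  rep₂ : Even n → RepUpToZeros ((3 * n + 2) / 2) (w ∷ʳ d2)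
  rep₂ even = subst (λ k → RepUpToZeros (k / 2) (w ∷ʳ d2)) (ℕ.+-comm 2 (3 * n))
                    (rep-∷ʳ d2 (from (∣m+n⇔∣n ∣-refl) even))
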